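{- Let $B$ be a broom with $b \ge 1$ hairs and $C$ an odd cycle. Let $F(B,C)$ be the graph obtained from $C$ by attaching to each vertex of $C$ a new star with $2b-1$ rays (i.e., $2b-1$ new pendant vertices adjacent to that cycle vertex). Then every $2$-colouring of the edges of $F(B,C)$ contains a monochromatic copy of $B$ or a monochromatic copy of $C$.
   Context: A broom with $b$ hairs is the tree obtained from a path of length two by attaching $b$ new leaves (hairs) to one of its endpoints. -}

module Defs where

open import Data.Nat using (ℕ; zero; suc; _+_; _*_; _∸_; _≤_; _%_)
open import Data.Fin using (Fin; toℕ)
open import Data.Sum using (_⊎_; inj₁; inj₂)
open import Data.Product using (Σ; _×_; _,_; ∃)
open import Data.Bool using (Bool)
open import Relation.Binary.PropositionalEquality using (_≡_)
open import Function.Definitions using (Injective)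

record Graph : Set₁ where
  field
    V   : Set
    Adj : V → V → Set
open Graph public

-- Cycle C_n on vertices 0,…,n-1 : i ~ i+1 and n-1 ~ 0 (symmetric closure).
-- (A genuine cycle when n ≥ 3.)
cycleArc : ∀ {n} → Fin n → Fin n → Set
cycleArc {n} i j = (suc (toℕ i) ≡ toℕ j) ⊎ ((toℕ i ≡ n ∸ 1) × (toℕ j ≡ 0))

cycleAdj : ∀ {n} → Fin n → Fin n → Set
cycleAdj i j = cycleArc i j ⊎ cycleArc j i

Cycle : ℕ → Graph
Cycle n = record { V = Fin n ; Adj = cycleAdj }

-- Broom with b hairs: path x(=0) - y(=1) - z(=2) of length two,
-- plus b new leaves (inj₂ h) attached to the endpoint z.
broomArc : ∀ {b} → Fin 3 ⊎ Fin b → Fin 3 ⊎ Fin b → Set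
broomArc (inj₁ i) (inj₁ j) = suc (toℕ i) ≡ toℕ j
broomArc (inj₁ i) (inj₂ h) = toℕ i ≡ 2
broomArc (inj₂ h) _        = Data.Empty.⊥
  where import Data.Empty

broomAdj : ∀ {b} → Fin 3 ⊎ Fin b → Fin 3 ⊎ Fin b → Set
broomAdj u v = broomArc u v ⊎ broomArc v u

Broom : ℕ → Graph
Broom b = record { V = Fin 3 ⊎ Fin b ; Adj = broomAdj }

FArc : ∀ {n m} → Fin n ⊎ (Fin n × Fin m) → Fin n ⊎ (Fin n × Fin m) → Set
FArc (inj₁ i) (inj₁ j)       = cycleAdj i j
FArc (inj₁ i) (inj₂ (j , r)) = i ≡ j
FArc (inj₂ _) _              = Data.Empty.⊥
  where import Data.Empty

FAdj : ∀ {n m} → Fin n ⊎ (Fin n × Fin m) → Fin n ⊎ (Fin n × Fin m) → Set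
FAdj u v = FArc u v ⊎ FArc v u

FBC : (b n : ℕ) → Graph
FBC b n = record { V = Fin n ⊎ (Fin n × Fin (2 * b ∸ 1)) ; Adj = FAdj {n} {2 * b ∸ 1} }

-- A 2-colouring of the edges of G: a colour for each pair of vertices,
-- symmetric (only values on edges matter).
record TwoColouring (G : Graph) : Set where
  field
    col     : V G → V G → Bool
    colSym  : ∀ u v → col u v ≡ col v u
open TwoColouring public

MonoCopy : (H G : Graph) → TwoColouring G → Bool → Set
MonoCopy H G c k =
  Σ (V H → V G) λ f →
    Injective _≡_ _≡_ f ×
    (∀ u v → Adj H u v → Adj G (f u) (f v) × col c (f u) (f v) ≡ k)

Odd : ℕ → Set
Odd n = n % 2 ≡ 1

-- Each cycle vertex v carries 2b − 1 pendant edges, so b of them share a colour p(v). Walk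
-- around the cycle and let e(v) be the colour of the edge from v to its successor. If an edge has
-- the colour of the star at its tail, then, unless there is a monochromatic broom, the next edge
-- and the next star both have the opposite colour, and the same happens again one step further:
-- the edge colours alternate all the way round, which an odd cycle forbids. Symmetrically no edge
-- has the colour of the star at its head. So every edge has the colour opposite to both stars at
-- its ends; hence all stars have one colour and the cycle is monochromatic in the other.

module Submission where

open import Defs
open import Data.Bool using (Bool; true; false; not)
open import Data.Bool.Properties using (_≟_; not-¬; ¬-not; not-involutive)
open import Data.Empty using (⊥-elim)
open import Data.Fin using (Fin; toℕ) renaming (zero to 0F; suc to fsuc)
open import Data.Fin.Patterns using (1F; 2F)
open import Data.Fin.Properties using (toℕ-fromℕ<; toℕ-injective; toℕ<n; any?)
import Data.Fin.Properties as Fin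
open import Data.Nat using (ℕ; zero; suc; _+_; _*_; _∸_; _%_; _≤_; s≤s)
open import Data.Nat.DivMod using (_mod_; m<n⇒m%n≡m; n%n≡0; m%n%n≡m%n; %-distribˡ-+; [m+n]%n≡m%n)
open import Data.Nat.GeneralisedArithmetic using (fold)
open import Data.Nat.Properties
  using (+-comm; +-suc; <⇒≤; +-identityʳ; ≤∧≢⇒<; ≤-reflexive; 1+n≢0; 1+n≢n; m≢1+n+m; n≤0⇒n≡0; suc-injective)
  renaming (_≟_ to _≟ℕ_)
open import Data.Product using (Σ; ∃; _×_; _,_; proj₁; proj₂; map₂)
open import Data.Product.Properties using (,-injectiveˡ; ,-injectiveʳ)
open import Data.Sum using (_⊎_; inj₁; inj₂; map; [_,_]′; swap)
open import Data.Sum.Properties using (inj₁-injective; inj₂-injective)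
open import Function using (_∘_; case_of_)
open import Function.Definitions using (Injective)
open import Relation.Nullary using (¬_; yes; no)
open import Relation.Nullary.Decidable using (_×-dec_; _⊎-dec_)
open import Relation.Unary using (Decidable)
open import Relation.Binary.PropositionalEquality
  using (_≡_; _≢_; refl; sym; trans; cong; subst; ≢-sym; module ≡-Reasoning)

odd-pred₂ : ∀ k → Odd (suc (suc k)) → Odd k
odd-pred₂ k odd = trans (sym ([m+n]%n≡m%n k 2)) (trans (cong (_% 2) (+-comm k 2)) odd)

fold-not-odd : ∀ k x → Odd k → fold x not k ≡ not x
fold-not-odd (suc zero)    x _   = refl
fold-not-odd (suc (suc k)) x odd =
  trans (not-involutive (fold x not k)) (fold-not-odd k x (odd-pred₂ k odd))

-- Read a ↦ next a as a cycle, e a as the colour of the edge a → next a and p a as the colour of a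
-- star of b hairs at a. Each obstruction yields a monochromatic broom: TailBroom the path
-- next² a, next a, a with the star at a; PendantBroom a hair of a, then a, next a with the star at
-- next a; HeadBroom the path a, next a, next² a with the star at next² a.
module WalkColouring {A : Set} (next : A → A) (p e : A → Bool) where

  TailBroom : A → Set
  TailBroom a = e a ≡ p a × e (next a) ≡ p a

  PendantBroom : A → Set
  PendantBroom a = e a ≡ p a × e a ≡ p (next a)

  HeadBroom : A → Set
  HeadBroom a = e a ≡ p (next (next a)) × e (next a) ≡ p (next (next a))

  Obstruction : A → Set
  Obstruction a = TailBroom a ⊎ PendantBroom a ⊎ HeadBroom a

  obstruction? : Decidable Obstruction
  obstruction? a =
    (e a ≟ p a ×-dec e (next a) ≟ p a) ⊎-dec
    (e a ≟ p a ×-dec e a ≟ p (next a)) ⊎-dec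
    (e a ≟ p (next (next a)) ×-dec e (next a) ≟ p (next (next a)))

  module Unobstructed (unobstructed : ∀ a → ¬ Obstruction a) where

    tail-step : ∀ {a} → e a ≡ p a → e (next a) ≡ p (next a) × e (next a) ≡ not (e a)
    tail-step {a} tail = trans flipped (sym (¬-not p≢e)) , flipped
      where
      flipped : e (next a) ≡ not (e a)
      flipped = ¬-not λ same → unobstructed a (inj₁ (tail , trans same tail))
      p≢e : p (next a) ≢ e a
      p≢e eq = unobstructed a (inj₂ (inj₁ (tail , sym eq)))

    head-step : ∀ {a} → e (next a) ≡ p (next (next a)) → e a ≡ p (next a) × e (next a) ≡ not (e a)
    head-step {a} head = trans (¬-not e≢e′) (sym (¬-not p≢e′)) , ¬-not (≢-sym e≢e′)
      where
      e≢e′ : e a ≢ e (next a)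
      e≢e′ eq = unobstructed a (inj₂ (inj₂ (trans eq head , head)))
      p≢e′ : p (next a) ≢ e (next a)
      p≢e′ eq = unobstructed (next a) (inj₂ (inj₁ (sym eq , head)))

    tail-run : ∀ {a} → e a ≡ p a → ∀ k →
               e (fold a next k) ≡ p (fold a next k) × e (fold a next k) ≡ fold (e a) not k
    tail-run tail zero    = tail , refl
    tail-run tail (suc k) with tail-run tail k
    ... | tailₖ , eₖ with tail-step tailₖ
    ...   | tailₖ₊₁ , flipped = tailₖ₊₁ , trans flipped (cong not eₖ)

    head-run : ∀ {a} k → e (fold a next k) ≡ p (next (fold a next k)) →
               e a ≡ p (next a) × e (fold a next k) ≡ fold (e a) not k
    head-run zero    head = head , refl
    head-run (suc k) head with head-step head
    ... | headₖ , flipped with head-run k headₖ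
    ...   | head₀ , eₖ = head₀ , trans flipped (cong not eₖ)

    module _ (n : ℕ) (n-odd : Odd n) (closed : ∀ a → fold a next n ≡ a) where
      open ≡-Reasoning

      ¬alternating : ∀ a → e (fold a next n) ≢ fold (e a) not n
      ¬alternating a alternating = not-¬ refl (begin
        e a               ≡⟨ cong e (closed a) ⟨
        e (fold a next n) ≡⟨ alternating ⟩
        fold (e a) not n  ≡⟨ fold-not-odd n (e a) n-odd ⟩
        not (e a)         ∎)

      edge≢tail : ∀ a → e a ≢ p a
      edge≢tail a tail = ¬alternating a (proj₂ (tail-run tail n))

      edge≢head : ∀ a → e a ≢ p (next a)
      edge≢head a head =
        ¬alternating a (proj₂ (head-run n (subst (λ b → e b ≡ p (next b)) (sym (closed a)) head)))

      edge-colour-constant : ∀ a → e (next a) ≡ e a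
      edge-colour-constant a = begin
        e (next a)         ≡⟨ ¬-not (edge≢tail (next a)) ⟩
        not (p (next a))   ≡⟨ cong not (¬-not (≢-sym (edge≢head a))) ⟩
        not (not (e a))    ≡⟨ not-involutive (e a) ⟩
        e a                ∎

record ColourClass {N : ℕ} (q : Fin N → Bool) (k : Bool) (r : ℕ) : Set where
  constructor colourClass
  field
    member    : Fin r → Fin N
    injective : Injective _≡_ _≡_ member
    coloured  : ∀ i → q (member i) ≡ k

module _ {N : ℕ} {q : Fin N → Bool} {k : Bool} where

  ColourClass-∅ : ColourClass q k 0
  ColourClass-∅ = colourClass (λ ()) (λ { {()} }) λ ()

module _ {N : ℕ} {q : Fin (suc N) → Bool} {k : Bool} where

  ColourClass-suc : ∀ {r} → ColourClass (q ∘ fsuc) k r → ColourClass q k r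
  ColourClass-suc (colourClass g g-inj g-col) = colourClass (fsuc ∘ g) (g-inj ∘ Fin.suc-injective) g-col

  ColourClass-cons : ∀ {r} → q 0F ≡ k → ColourClass (q ∘ fsuc) k r → ColourClass q k (suc r)
  ColourClass-cons {r} q₀ (colourClass g g-inj g-col) = colourClass g′ g′-inj g′-col
    where
    g′ : Fin (suc r) → Fin (suc N)
    g′ 0F       = 0F
    g′ (fsuc i) = fsuc (g i)
    g′-inj : Injective _≡_ _≡_ g′
    g′-inj {0F}     {0F}     _  = refl
    g′-inj {fsuc i} {fsuc j} eq = cong fsuc (g-inj (Fin.suc-injective eq))
    g′-col : ∀ i → q (g′ i) ≡ k
    g′-col 0F       = q₀
    g′-col (fsuc i) = g-col i

pigeonhole : ∀ {N} (q : Fin N → Bool) r s → r + s ≤ suc N →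
             ColourClass q true r ⊎ ColourClass q false s
pigeonhole q zero    s       _ = inj₁ ColourClass-∅
pigeonhole q (suc r) zero    _ = inj₂ ColourClass-∅
pigeonhole {zero}  q (suc r) (suc s) (s≤s r+1+s≤0) =
  ⊥-elim (1+n≢0 (trans (sym (+-suc r s)) (n≤0⇒n≡0 r+1+s≤0)))
pigeonhole {suc N} q (suc r) (suc s) (s≤s r+1+s≤1+N) with q 0F in q₀
... | true  = map (ColourClass-cons q₀) ColourClass-suc (pigeonhole (q ∘ fsuc) r (suc s) r+1+s≤1+N)
... | false = map ColourClass-suc (ColourClass-cons q₀)
                (pigeonhole (q ∘ fsuc) (suc r) s (subst (_≤ suc N) (+-suc r s) r+1+s≤1+N))

MonoEdge : (G : Graph) → TwoColouring G → Bool → V G → V G → Set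
MonoEdge G c k u v = Adj G u v × col c u v ≡ k

module _ {G : Graph} (c : TwoColouring G) (Adj-sym : ∀ {u v} → Adj G u v → Adj G v u) {k : Bool} where

  MonoEdge-sym : ∀ {u v} → MonoEdge G c k u v → MonoEdge G c k v u
  MonoEdge-sym {u} {v} (uv , uv-col) = Adj-sym uv , trans (colSym c v u) uv-col

  broomCopy : ∀ {b} (x y z : V G) (hair : Fin b → V G) → Injective _≡_ _≡_ hair →
              x ≢ y → x ≢ z → y ≢ z → (∀ i → hair i ≢ x) → (∀ i → hair i ≢ y) → (∀ i → hair i ≢ z) →
              MonoEdge G c k x y → MonoEdge G c k y z → (∀ i → MonoEdge G c k z (hair i)) →
              MonoCopy (Broom b) G c k
  broomCopy {b} x y z hair hair-inj x≢y x≢z y≢z h≢x h≢y h≢z xy yz zh = f , f-inj , edge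
    where
    f : Fin 3 ⊎ Fin b → V G
    f (inj₁ 0F) = x
    f (inj₁ 1F) = y
    f (inj₁ 2F) = z
    f (inj₂ i)  = hair i

    f-inj : Injective _≡_ _≡_ f
    f-inj {inj₁ 0F} {inj₁ 0F} _  = refl
    f-inj {inj₁ 0F} {inj₁ 1F} eq = ⊥-elim (x≢y eq)
    f-inj {inj₁ 0F} {inj₁ 2F} eq = ⊥-elim (x≢z eq)
    f-inj {inj₁ 1F} {inj₁ 0F} eq = ⊥-elim (x≢y (sym eq))
    f-inj {inj₁ 1F} {inj₁ 1F} _  = refl
    f-inj {inj₁ 1F} {inj₁ 2F} eq = ⊥-elim (y≢z eq)
    f-inj {inj₁ 2F} {inj₁ 0F} eq = ⊥-elim (x≢z (sym eq))
    f-inj {inj₁ 2F} {inj₁ 1F} eq = ⊥-elim (y≢z (sym eq))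
    f-inj {inj₁ 2F} {inj₁ 2F} _  = refl
    f-inj {inj₁ 0F} {inj₂ i}  eq = ⊥-elim (h≢x i (sym eq))
    f-inj {inj₁ 1F} {inj₂ i}  eq = ⊥-elim (h≢y i (sym eq))
    f-inj {inj₁ 2F} {inj₂ i}  eq = ⊥-elim (h≢z i (sym eq))
    f-inj {inj₂ i}  {inj₁ 0F} eq = ⊥-elim (h≢x i eq)
    f-inj {inj₂ i}  {inj₁ 1F} eq = ⊥-elim (h≢y i eq)
    f-inj {inj₂ i}  {inj₁ 2F} eq = ⊥-elim (h≢z i eq)
    f-inj {inj₂ i}  {inj₂ j}  eq = cong inj₂ (hair-inj eq)

    arc : ∀ u v → broomArc u v → MonoEdge G c k (f u) (f v)
    arc (inj₁ 0F) (inj₁ 1F) _ = xy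
    arc (inj₁ 1F) (inj₁ 2F) _ = yz
    arc (inj₁ 2F) (inj₂ i)  _ = zh i
    arc (inj₁ 0F) (inj₁ 0F) ()
    arc (inj₁ 0F) (inj₁ 2F) ()
    arc (inj₁ 1F) (inj₁ 0F) ()
    arc (inj₁ 1F) (inj₁ 1F) ()
    arc (inj₁ 2F) (inj₁ 0F) ()
    arc (inj₁ 2F) (inj₁ 1F) ()
    arc (inj₁ 2F) (inj₁ 2F) ()
    arc (inj₁ 0F) (inj₂ _)  ()
    arc (inj₁ 1F) (inj₂ _)  ()

    edge : ∀ u v → broomAdj u v → MonoEdge G c k (f u) (f v)
    edge u v (inj₁ uv) = arc u v uv
    edge u v (inj₂ vu) = MonoEdge-sym (arc v u vu)

cycleArc-irreflexive : ∀ {n} {u : Fin n} → 2 ≤ n → ¬ cycleArc u u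
cycleArc-irreflexive _             (inj₁ uu)             = 1+n≢n uu
cycleArc-irreflexive (s≤s (s≤s _)) (inj₂ (last , first)) = 1+n≢0 (trans (sym last) first)

cycleArc-asymmetric : ∀ {n} {u v : Fin n} → 3 ≤ n → cycleArc u v → ¬ cycleArc v u
cycleArc-asymmetric _ (inj₁ uv) (inj₁ vu) = m≢1+n+m _ (sym (trans (cong suc uv) vu))
cycleArc-asymmetric (s≤s (s≤s (s≤s _))) (inj₁ uv) (inj₂ (last , first)) =
  1+n≢0 (suc-injective (trans (sym last) (trans (sym uv) (cong suc first))))
cycleArc-asymmetric (s≤s (s≤s (s≤s _))) (inj₂ (last , first)) (inj₁ vu) =
  1+n≢0 (suc-injective (trans (sym last) (trans (sym vu) (cong suc first))))
cycleArc-asymmetric (s≤s (s≤s (s≤s _))) (inj₂ (_ , first)) (inj₂ (last , _)) = 1+n≢0 (trans (sym last) first)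

module Rotation (m : ℕ) where
  open ≡-Reasoning

  next : Fin (suc m) → Fin (suc m)
  next i = suc (toℕ i) mod suc m

  [1+m%n]%n≡[1+m]%n : ∀ j → suc (j % suc m) % suc m ≡ suc j % suc m
  [1+m%n]%n≡[1+m]%n j = begin
    (1 + j % suc m) % suc m                   ≡⟨ %-distribˡ-+ 1 (j % suc m) (suc m) ⟩
    (1 % suc m + j % suc m % suc m) % suc m   ≡⟨ cong (λ r → (1 % suc m + r) % suc m) (m%n%n≡m%n j (suc m)) ⟩
    (1 % suc m + j % suc m) % suc m           ≡⟨ %-distribˡ-+ 1 j (suc m) ⟨
    (1 + j) % suc m                           ∎

  toℕ-fold-next : ∀ i k → toℕ (fold i next k) ≡ (k + toℕ i) % suc m
  toℕ-fold-next i zero    = sym (m<n⇒m%n≡m (toℕ<n i))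
  toℕ-fold-next i (suc k) = begin
    toℕ (next (fold i next k))                 ≡⟨ toℕ-fromℕ< _ ⟩
    suc (toℕ (fold i next k)) % suc m          ≡⟨ cong (λ j → suc j % suc m) (toℕ-fold-next i k) ⟩
    suc ((k + toℕ i) % suc m) % suc m          ≡⟨ [1+m%n]%n≡[1+m]%n (k + toℕ i) ⟩
    suc (k + toℕ i) % suc m                    ∎

  fold-next-period : ∀ i → fold i next (suc m) ≡ i
  fold-next-period i = toℕ-injective (begin
    toℕ (fold i next (suc m))   ≡⟨ toℕ-fold-next i (suc m) ⟩
    (suc m + toℕ i) % suc m     ≡⟨ cong (_% suc m) (+-comm (suc m) (toℕ i)) ⟩
    (toℕ i + suc m) % suc m     ≡⟨ [m+n]%n≡m%n (toℕ i) (suc m) ⟩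
    toℕ i % suc m               ≡⟨ m<n⇒m%n≡m (toℕ<n i) ⟩
    toℕ i                       ∎)

  fold-0F-next-toℕ : ∀ i → fold 0F next (toℕ i) ≡ i
  fold-0F-next-toℕ i = toℕ-injective (begin
    toℕ (fold 0F next (toℕ i))  ≡⟨ toℕ-fold-next 0F (toℕ i) ⟩
    (toℕ i + 0) % suc m         ≡⟨ cong (_% suc m) (+-identityʳ (toℕ i)) ⟩
    toℕ i % suc m               ≡⟨ m<n⇒m%n≡m (toℕ<n i) ⟩
    toℕ i                       ∎)

  cycleArc-next : ∀ i → cycleArc i (next i)
  cycleArc-next i with toℕ i ≟ℕ m | toℕ<n i
  ... | yes last | _       =
    inj₂ (last , trans (toℕ-fromℕ< _) (trans (cong (λ j → suc j % suc m) last) (n%n≡0 (suc m))))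
  ... | no ¬last | s≤s i≤m = inj₁ (sym (trans (toℕ-fromℕ< _) (m<n⇒m%n≡m (s≤s (≤∧≢⇒< i≤m ¬last)))))

  cycleArc⇒next : ∀ {u v} → cycleArc u v → v ≡ next u
  cycleArc⇒next {u} {v} (inj₁ uv) = toℕ-injective (begin
    toℕ v                ≡⟨ m<n⇒m%n≡m (toℕ<n v) ⟨
    toℕ v % suc m        ≡⟨ cong (_% suc m) uv ⟨
    suc (toℕ u) % suc m  ≡⟨ toℕ-fromℕ< _ ⟨
    toℕ (next u)         ∎)
  cycleArc⇒next {u} {v} (inj₂ (last , first)) = toℕ-injective (begin
    toℕ v                ≡⟨ first ⟩
    0                    ≡⟨ n%n≡0 (suc m) ⟨
    suc m % suc m        ≡⟨ cong (λ j → suc j % suc m) last ⟨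
    suc (toℕ u) % suc m  ≡⟨ toℕ-fromℕ< _ ⟨
    toℕ (next u)         ∎)

module BroomOrCycle {b m : ℕ} (c : TwoColouring (FBC (suc b) (suc m))) where
  open Rotation m

  G : Graph
  G = FBC (suc b) (suc m)

  Hairs : Fin (suc m) → Bool → Set
  Hairs z k = ColourClass (λ r → col c (inj₁ z) (inj₂ (z , r))) k (suc b)

  majority : ∀ z → Σ Bool (Hairs z)
  majority z = [ (true ,_) , (false ,_) ]′
    (pigeonhole (λ r → col c (inj₁ z) (inj₂ (z , r))) (suc b) (suc b) enough-hairs)
    where
    enough-hairs : suc b + suc b ≤ suc (2 * suc b ∸ 1)
    enough-hairs = ≤-reflexive (cong (λ j → suc (b + suc j)) (sym (+-identityʳ b)))

  hairColour : Fin (suc m) → Bool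
  hairColour = proj₁ ∘ majority

  cycleColour : Fin (suc m) → Bool
  cycleColour u = col c (inj₁ u) (inj₁ (next u))

  open WalkColouring next hairColour cycleColour public

  edge-sym : ∀ {k u v} → MonoEdge G c k u v → MonoEdge G c k v u
  edge-sym = MonoEdge-sym c swap

  recolour : ∀ {k k′ u v} → k ≡ k′ → MonoEdge G c k u v → MonoEdge G c k′ u v
  recolour refl uv = uv

  cycleEdge : ∀ a → MonoEdge G c (cycleColour a) (inj₁ a) (inj₁ (next a))
  cycleEdge a = inj₁ (inj₁ (cycleArc-next a)) , refl

  pendantEdge : ∀ {a k} (hairs : Hairs a k) →
                MonoEdge G c k (inj₂ (a , ColourClass.member hairs 0F)) (inj₁ a)
  pendantEdge hairs = inj₂ refl , trans (colSym c _ _) (ColourClass.coloured hairs 0F)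

  broomAt : ∀ {k} (x : V G) {y z : Fin (suc m)} →
            y ≢ z → x ≢ inj₁ y → x ≢ inj₁ z → (∀ {r} → x ≢ inj₂ (z , r)) →
            MonoEdge G c k x (inj₁ y) → MonoEdge G c k (inj₁ y) (inj₁ z) → Hairs z k →
            MonoCopy (Broom (suc b)) G c k
  broomAt x {y} {z} y≢z x≢y x≢z x≢hair xy yz (colourClass g g-inj g-col) =
    broomCopy c swap x (inj₁ y) (inj₁ z) (λ i → inj₂ (z , g i)) (g-inj ∘ ,-injectiveʳ ∘ inj₂-injective)
      x≢y x≢z (y≢z ∘ inj₁-injective) (λ _ → ≢-sym x≢hair) (λ _ ()) (λ _ ())
      xy yz (λ i → inj₁ refl , g-col i)

  module _ (3≤n : 3 ≤ suc m) where

    next≢ : ∀ a → next a ≢ a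
    next≢ a eq = cycleArc-irreflexive (<⇒≤ 3≤n) (subst (cycleArc a) eq (cycleArc-next a))

    next²≢ : ∀ a → next (next a) ≢ a
    next²≢ a eq =
      cycleArc-asymmetric 3≤n (cycleArc-next a) (subst (cycleArc (next a)) eq (cycleArc-next (next a)))

    obstruction⇒broom : ∀ a → Obstruction a → ∃ λ k → MonoCopy (Broom (suc b)) G c k
    obstruction⇒broom a (inj₁ (tail , tail′)) =
      hairColour a , broomAt (inj₁ (next (next a))) (next≢ a) (next≢ (next a) ∘ inj₁-injective)
        (next²≢ a ∘ inj₁-injective) (λ ())
        (recolour tail′ (edge-sym (cycleEdge (next a)))) (recolour tail (edge-sym (cycleEdge a)))
        (proj₂ (majority a))
    obstruction⇒broom a (inj₂ (inj₁ (tail , head))) =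
      cycleColour a , broomAt (inj₂ (a , ColourClass.member hairs 0F)) (≢-sym (next≢ a)) (λ ()) (λ ())
        (next≢ a ∘ sym ∘ ,-injectiveˡ ∘ inj₂-injective)
        (recolour (sym tail) (pendantEdge hairs)) (cycleEdge a)
        (subst (Hairs (next a)) (sym head) (proj₂ (majority (next a))))
      where hairs = proj₂ (majority a)
    obstruction⇒broom a (inj₂ (inj₂ (head , head′))) =
      hairColour (next (next a)) , broomAt (inj₁ a) (≢-sym (next≢ (next a))) (≢-sym (next≢ a) ∘ inj₁-injective)
        (≢-sym (next²≢ a) ∘ inj₁-injective) (λ ())
        (recolour head (cycleEdge a)) (recolour head′ (cycleEdge (next a)))
        (proj₂ (majority (next (next a))))

  monoCycle : (∀ a → cycleColour (next a) ≡ cycleColour a) → MonoCopy (Cycle (suc m)) G c (cycleColour 0F)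
  monoCycle constant = inj₁ , inj₁-injective , edge
    where
    along : ∀ k → cycleColour (fold 0F next k) ≡ cycleColour 0F
    along zero    = refl
    along (suc k) = trans (constant _) (along k)

    uniform : ∀ u → cycleColour u ≡ cycleColour 0F
    uniform u = subst (λ v → cycleColour v ≡ cycleColour 0F) (fold-0F-next-toℕ u) (along (toℕ u))

    arc : ∀ u v → cycleArc u v → MonoEdge G c (cycleColour 0F) (inj₁ u) (inj₁ v)
    arc u v uv = subst (MonoEdge G c _ (inj₁ u) ∘ inj₁) (sym (cycleArc⇒next uv)) (recolour (uniform u) (cycleEdge u))

    edge : ∀ u v → cycleAdj u v → MonoEdge G c (cycleColour 0F) (inj₁ u) (inj₁ v)
    edge u v (inj₁ uv) = arc u v uv
    edge u v (inj₂ vu) = edge-sym (arc v u vu)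

mainTheorem19 : (b n : ℕ) → 1 ≤ b → 3 ≤ n → Odd n →
    (c : TwoColouring (FBC b n)) →
    ∃ λ (k : Bool) → MonoCopy (Broom b) (FBC b n) c k ⊎ MonoCopy (Cycle n) (FBC b n) c k
mainTheorem19 zero    _       ()  _   _   _
mainTheorem19 (suc b) zero    _   ()  _   _
mainTheorem19 (suc b) (suc m) _   3≤n odd c = case any? obstruction? of λ where
    (yes (a , obstructed)) → map₂ inj₁ (obstruction⇒broom 3≤n a obstructed)
    (no unobstructed)      → cycleColour 0F , inj₂ (monoCycle
      (Unobstructed.edge-colour-constant (λ a obstructed → unobstructed (a , obstructed))
        (suc m) odd fold-next-period))
  where
  open BroomOrCycle c
  open Rotation m
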